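{- Let $\mathcal{H}$ be an $m$-uniform hypergraph, let $e=\{u,v,v_1,\dots,v_{m-2}\}$ be an edge of $\mathcal{H}$, and let $e_1,\dots,e_t$ ($t\ge1$) be the pendent edges incident with $u$, where $d_{\mathcal{H}}(u)=t+1$ and $d_{\mathcal{H}}(v)\ge2$. Put $e_i'=(e_i\setminus\{u\})\cup\{v\}$ and $\mathcal{H}'=\mathcal{H}-\{e_1,\dots,e_t\}+\{e_1',\dots,e_t'\}$. Then $M(\mathcal{H}')>M(\mathcal{H})$.
   Context: $d_{\mathcal{H}}(w)$ is the degree of vertex $w$ (number of edges containing it). A core vertex is a vertex of degree one; a pendent edge is an edge $f$ containing $|f|-1$ core vertices. $\mathcal{H}-E'$ deletes the edges in $E'$, and $+$ adds edges. The Zagreb index $M(\mathcal{H})$ is the sum of the squares of the degrees of all vertices of $\mathcal{H}$. -}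

module Defs where

open import Data.Nat using (ℕ; _+_; _*_; _∸_)
open import Data.Bool using (Bool)
open import Data.Bool.Properties renaming (_≟_ to _≟ᵇ_)
open import Data.Fin using (Fin)
open import Data.Fin.Subset using (Subset; _∈_; _∪_; _-_; ⁅_⁆; ∣_∣)
open import Data.Fin.Subset.Properties using (_∈?_)
open import Data.Vec.Properties using (≡-dec)
open import Data.List using (List; length; filter; map; allFin; _++_)
open import Data.Nat.ListAction using (sum)
open import Data.Nat using () renaming (_≟_ to _≟ℕ_)
open import Relation.Binary.PropositionalEquality using (_≡_)
open import Relation.Binary.Definitions using (DecidableEquality)
open import Relation.Nullary.Decidable using (¬?)
import Data.List.Membership.DecPropositional as DecMem

-- A hypergraph on vertex set Fin n is given by its list of edges,
-- each edge being a subset of the vertex set.  (Simplicity, i.e. no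
-- repeated edges, and uniformity are imposed as hypotheses.)

_≟ₛ_ : ∀ {n} → DecidableEquality (Subset n)
_≟ₛ_ = ≡-dec _≟ᵇ_

module _ {n : ℕ} where
  open DecMem (_≟ₛ_ {n}) public using () renaming (_∈_ to _∈ₑ_; _∈?_ to _∈ₑ?_)

degree : ∀ {n} → List (Subset n) → Fin n → ℕ
degree E w = length (filter (w ∈?_) E)

Core : ∀ {n} → List (Subset n) → Fin n → Set
Core E w = degree E w ≡ 1

coreCount : ∀ {n} → List (Subset n) → Subset n → ℕ
coreCount E f = length (filter (λ w → w ∈? f) (filter (λ w → degree E w ≟ℕ 1) (allFin _)))

Pendent : ∀ {n} → List (Subset n) → Subset n → Set
Pendent E f = coreCount E f ≡ ∣ f ∣ ∸ 1

zagreb : ∀ {n} → List (Subset n) → ℕ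
zagreb {n} E = sum (map (λ w → degree E w * degree E w) (allFin n))

moveEdge : ∀ {n} → Fin n → Fin n → Subset n → Subset n
moveEdge u v f = (f - u) ∪ ⁅ v ⁆

transform : ∀ {n} → List (Subset n) → List (Subset n) → Fin n → Fin n → List (Subset n)
transform E P u v = filter (λ f → ¬? (f ∈ₑ? P)) E ++ map (moveEdge u v) P

-- Write t = |P| and d = d(v).  A pendent edge through u has all its vertices
-- but one core, and u is not core (d(u) = t + 1 ≥ 2); v is not core either
-- (d ≥ 2), so no edge of P contains v.  Moving the edges of P from u to v thus
-- changes only two degrees, d(u) = t + 1 ↦ 1 and d ↦ d + t, and the Zagreb
-- index grows by 1 + (d + t)² − (t + 1)² − d² = 2t(d − 1) > 0.

module Submission where

open import Defs
open import Data.Nat using (ℕ; zero; suc; _+_; _*_; _∸_; _≤_; _<_; z≤n; s≤s; z<s) renaming (_≟_ to _≟ℕ_)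
open import Data.Nat.Tactic.RingSolver using (solve-∀)
open import Data.Nat.Properties
open import Algebra.Properties.CommutativeSemigroup +-commutativeSemigroup using (xy∙z≈zy∙x; xy∙z≈zx∙y; interchange)
open import Data.Nat.ListAction using (sum)
open import Data.Fin as Fin using (Fin) renaming (_≟_ to _≟ᶠ_)
open import Data.Fin.Subset using (Subset; _∈_; _∉_; _─_; ⁅_⁆; ∣_∣; inside; outside)
open import Data.Fin.Subset.Properties
  using (_∈?_; drop-there; x∈p∪q⁻; x∈p∪q⁺; x∈⁅x⁆; x∈⁅y⁆⇒x≡y; x∈p∧x≢y⇒x∈p-y; p─q⊆p)
open import Data.List using (List; []; _∷_; length; filter; map; _++_; allFin; tabulate)
open import Data.List.Properties using (filter-++; length-++; map-cong-local; length-map; filter-all; filter-none; map-tabulate; partition-defn)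
open import Data.List.Relation.Unary.All as All using (All; universal)
open import Data.List.Relation.Unary.All.Properties using (map⁺)
open import Data.List.Relation.Unary.Any using (here; there)
open import Data.List.Relation.Unary.Unique.Propositional using (Unique; _∷_)
open import Data.List.Relation.Unary.Unique.Propositional.Properties using (allFin⁺) renaming (filter⁺ to Unique-filter⁺)
open import Data.List.Membership.Propositional using () renaming (_∈_ to _∈ˡ_)
open import Data.List.Membership.Propositional.Properties using (∈-filter⁺; ∈-filter⁻; ∈-allFin)
open import Data.List.Membership.Propositional.Properties.WithK using (unique∧set⇒bag)
import Data.List.Membership.DecPropositional as DecMembership
open import Data.List.Relation.Binary.Subset.Propositional using (_⊆_)
open import Data.List.Relation.Binary.BagAndSetEquality using (∼bag⇒↭)
open import Data.List.Relation.Binary.Permutation.Propositional using (_↭_; ↭ₛ⇒↭)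
open import Data.List.Relation.Binary.Permutation.Propositional.Properties using (filter-↭; ↭-length)
import Data.List.Relation.Binary.Permutation.Setoid.Properties as PermutationₛProperties
open import Data.Product using (_×_; _,_; proj₁; proj₂)
open import Data.Sum using (inj₁; inj₂)
import Data.Vec as Vec
open import Function using (_∘_; id)
open import Function.Bundles using (_⇔_; mk⇔; Equivalence)
open import Relation.Nullary using (¬_; yes; no; contradiction)
open import Relation.Nullary.Decidable using (¬?)
open import Relation.Unary using (Decidable)
open import Relation.Unary.Properties using (∁?)
open import Relation.Binary.PropositionalEquality
open import Relation.Binary.Definitions using (DecidableEquality)

module _ {A : Set} where

  length-filter-partition : ∀ {P Q : A → Set} (P? : Decidable P) (Q? : Decidable Q) xs →
    length (filter Q? xs) ≡ length (filter Q? (filter P? xs)) + length (filter Q? (filter (∁? P?) xs))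
  length-filter-partition P? Q? xs = begin
    length (filter Q? xs)                                     ≡⟨ ↭-length (filter-↭ Q? xs↭) ⟩
    length (filter Q? (filter P? xs ++ filter (∁? P?) xs))    ≡⟨ cong length (filter-++ Q? (filter P? xs) _) ⟩
    length (filter Q? (filter P? xs) ++ filter Q? (filter (∁? P?) xs))
                                                              ≡⟨ length-++ (filter Q? (filter P? xs)) ⟩
    length (filter Q? (filter P? xs)) + length (filter Q? (filter (∁? P?) xs)) ∎
    where
    open ≡-Reasoning
    xs↭ : xs ↭ filter P? xs ++ filter (∁? P?) xs
    xs↭ = subst (λ (ys , zs) → xs ↭ ys ++ zs) (partition-defn P? xs)
                (↭ₛ⇒↭ (PermutationₛProperties.partition-↭ (setoid A) P? xs))

  module _ {B : Set} {P : B → Set} {Q : A → Set} (P? : Decidable P) (Q? : Decidable Q) (f : A → B)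
           (P∘f⇔Q : ∀ x → P (f x) ⇔ Q x) where

    length-filter-map : ∀ xs → length (filter P? (map f xs)) ≡ length (filter Q? xs)
    length-filter-map [] = refl
    length-filter-map (x ∷ xs) with P? (f x) | Q? x
    ... | yes _   | yes _  = cong suc (length-filter-map xs)
    ... | no _    | no _   = length-filter-map xs
    ... | yes pfx | no ¬qx = contradiction (Equivalence.to (P∘f⇔Q x) pfx) ¬qx
    ... | no ¬pfx | yes qx = contradiction (Equivalence.from (P∘f⇔Q x) qx) ¬pfx

  2≤length : ∀ {x y : A} {xs} → x ∈ˡ xs → y ∈ˡ xs → x ≢ y → 2 ≤ length xs
  2≤length {xs = _ ∷ _ ∷ _} _ _ _ = s≤s (s≤s z≤n)
  2≤length {xs = _ ∷ []} (here refl) (here refl) x≢y = contradiction refl x≢y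
  2≤length {xs = _ ∷ []} (there ()) _ _
  2≤length {xs = _ ∷ []} _ (there ()) _

  module _ (_≟_ : DecidableEquality A) where
    open DecMembership _≟_ using () renaming (_∈?_ to _∈ˡ?_)

    filter-∈-↭ : ∀ {xs ys} → Unique xs → Unique ys → ys ⊆ xs → filter (_∈ˡ? ys) xs ↭ ys
    filter-∈-↭ {xs} {ys} xs! ys! ys⊆xs = ∼bag⇒↭ (unique∧set⇒bag (Unique-filter⁺ _ xs!) ys!
      (mk⇔ (λ m → proj₂ (∈-filter⁻ (_∈ˡ? ys) {xs = xs} m)) (λ m → ∈-filter⁺ (_∈ˡ? ys) (ys⊆xs m) m)))

  module _ (g h : A → ℕ) where

    sum-map-exchange : ∀ {u xs} → Unique xs → u ∈ˡ xs → (∀ {w} → w ∈ˡ xs → w ≢ u → g w ≡ h w) →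
      sum (map g xs) + h u ≡ sum (map h xs) + g u
    sum-map-exchange {xs = x ∷ xs} (x∉xs ∷ _) (here refl) agree = begin
      g x + sum (map g xs) + h x ≡⟨ cong (λ s → g x + s + h x) (cong sum (map-cong-local (All.tabulate agree-xs))) ⟩
      g x + sum (map h xs) + h x ≡⟨ xy∙z≈zy∙x (g x) _ _ ⟩
      h x + sum (map h xs) + g x ∎
      where
      open ≡-Reasoning
      agree-xs : ∀ {w} → w ∈ˡ xs → g w ≡ h w
      agree-xs w∈xs = agree (there w∈xs) (λ w≡x → All.lookup x∉xs w∈xs (sym w≡x))
    sum-map-exchange {u} {x ∷ xs} (x∉xs ∷ xs!) (there u∈xs) agree = begin
      g x + sum (map g xs) + h u   ≡⟨ +-assoc (g x) _ _ ⟩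
      g x + (sum (map g xs) + h u) ≡⟨ cong₂ _+_ (agree (here refl) (All.lookup x∉xs u∈xs))
                                                (sum-map-exchange xs! u∈xs (agree ∘ there)) ⟩
      h x + (sum (map h xs) + g u) ≡⟨ +-assoc (h x) _ _ ⟨
      h x + sum (map h xs) + g u   ∎
      where open ≡-Reasoning

    sum-map-exchange₂ : ∀ {u v xs} → Unique xs → u ∈ˡ xs → v ∈ˡ xs → u ≢ v →
      (∀ {w} → w ∈ˡ xs → w ≢ u → w ≢ v → g w ≡ h w) →
      sum (map g xs) + (h u + h v) ≡ sum (map h xs) + (g u + g v)
    sum-map-exchange₂ {xs = x ∷ xs} (x∉xs ∷ xs!) = go
      where
      open ≡-Reasoning
      x≢ : ∀ {w} → w ∈ˡ xs → x ≢ w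
      x≢ = All.lookup x∉xs

      exchange-head : ∀ {y} → y ∈ˡ xs → (∀ {w} → w ∈ˡ x ∷ xs → w ≢ x → w ≢ y → g w ≡ h w) →
        sum (map g (x ∷ xs)) + (h x + h y) ≡ sum (map h (x ∷ xs)) + (g x + g y)
      exchange-head {y} y∈xs agree = begin
        g x + sum (map g xs) + (h x + h y)   ≡⟨ interchange (g x) _ _ _ ⟩
        g x + h x + (sum (map g xs) + h y)   ≡⟨ cong₂ _+_ (+-comm (g x) _) (sum-map-exchange xs! y∈xs agree-xs) ⟩
        h x + g x + (sum (map h xs) + g y)   ≡⟨ interchange (h x) _ _ _ ⟩
        h x + sum (map h xs) + (g x + g y)   ∎
        where
        agree-xs : ∀ {w} → w ∈ˡ xs → w ≢ y → g w ≡ h w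
        agree-xs w∈xs = agree (there w∈xs) (λ w≡x → x≢ w∈xs (sym w≡x))

      go : ∀ {u v} → u ∈ˡ x ∷ xs → v ∈ˡ x ∷ xs → u ≢ v → (∀ {w} → w ∈ˡ x ∷ xs → w ≢ u → w ≢ v → g w ≡ h w) →
        sum (map g (x ∷ xs)) + (h u + h v) ≡ sum (map h (x ∷ xs)) + (g u + g v)
      go (here refl) (here refl) u≢v agree = contradiction refl u≢v
      go (here refl) (there v∈xs) u≢v agree = exchange-head v∈xs agree
      go {u} {v} (there u∈xs) (here refl) u≢v agree = begin
        sum (map g (x ∷ xs)) + (h u + h v) ≡⟨ cong (sum (map g (x ∷ xs)) +_) (+-comm (h u) _) ⟩
        sum (map g (x ∷ xs)) + (h v + h u) ≡⟨ exchange-head u∈xs (λ w∈ w≢v w≢u → agree w∈ w≢u w≢v) ⟩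
        sum (map h (x ∷ xs)) + (g v + g u) ≡⟨ cong (sum (map h (x ∷ xs)) +_) (+-comm (g v) _) ⟩
        sum (map h (x ∷ xs)) + (g u + g v) ∎
      go {u} {v} (there u∈xs) (there v∈xs) u≢v agree = begin
        g x + sum (map g xs) + (h u + h v)   ≡⟨ +-assoc (g x) _ _ ⟩
        g x + (sum (map g xs) + (h u + h v)) ≡⟨ cong₂ _+_ (agree (here refl) (x≢ u∈xs) (x≢ v∈xs))
                                                 (sum-map-exchange₂ xs! u∈xs v∈xs u≢v (agree ∘ there)) ⟩
        h x + (sum (map h xs) + (g u + g v)) ≡⟨ +-assoc (h x) _ _ ⟨
        h x + sum (map h xs) + (g u + g v)   ∎

    sum-map-<-exchange₂ : ∀ {u v xs} → Unique xs → u ∈ˡ xs → v ∈ˡ xs → u ≢ v →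
      (∀ {w} → w ∈ˡ xs → w ≢ u → w ≢ v → g w ≡ h w) → g u + g v < h u + h v →
      sum (map g xs) < sum (map h xs)
    sum-map-<-exchange₂ {u} {v} {xs} xs! u∈xs v∈xs u≢v agree gain = +-cancelʳ-< (g u + g v) _ _ (begin-strict
      sum (map g xs) + (g u + g v) <⟨ +-monoʳ-< (sum (map g xs)) gain ⟩
      sum (map g xs) + (h u + h v) ≡⟨ sum-map-exchange₂ xs! u∈xs v∈xs u≢v agree ⟩
      sum (map h xs) + (g u + g v) ∎)
      where open ≤-Reasoning

sum-of-squares-shift-< : ∀ a d t → a < d → 0 < t → (a + t) * (a + t) + d * d < a * a + (d + t) * (d + t)
sum-of-squares-shift-< a d (suc s) a<d _ with k , refl ← m≤n⇒∃[o]m+o≡n a<d = begin-strict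
  (a + suc s) * (a + suc s) + (suc a + k) * (suc a + k)                     <⟨ m<m+n _ z<s ⟩
  (a + suc s) * (a + suc s) + (suc a + k) * (suc a + k) + 2 * suc s * suc k ≡⟨ expand a k s ⟩
  a * a + (suc a + k + suc s) * (suc a + k + suc s)                         ∎
  where
  open ≤-Reasoning
  expand : ∀ a k s → (a + suc s) * (a + suc s) + (suc a + k) * (suc a + k) + 2 * suc s * suc k
                   ≡ a * a + (suc a + k + suc s) * (suc a + k + suc s)
  expand = solve-∀

module _ where
  open import Data.Vec using ([]; _∷_)

  x∈p─q⇒x∉q : ∀ {n} {x : Fin n} (p q : Subset n) → x ∈ p ─ q → x ∉ q
  x∈p─q⇒x∉q (inside ∷ p) (outside ∷ q) Vec.here ()
  x∈p─q⇒x∉q (_ ∷ p) (_ ∷ q) (Vec.there x∈p─q) (Vec.there x∈q) = x∈p─q⇒x∉q p q x∈p─q x∈q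

  ∣p∣≡length-filter-allFin : ∀ {n} (p : Subset n) → ∣ p ∣ ≡ length (filter (_∈? p) (allFin n))
  ∣p∣≡length-filter-tail : ∀ {n} s (p : Subset n) → ∣ p ∣ ≡ length (filter (_∈? s ∷ p) (tabulate Fin.suc))
  ∣p∣≡length-filter-allFin [] = refl
  ∣p∣≡length-filter-allFin {suc n} (inside ∷ p) = cong suc (∣p∣≡length-filter-tail inside p)
  ∣p∣≡length-filter-allFin {suc n} (outside ∷ p) = ∣p∣≡length-filter-tail outside p

  ∣p∣≡length-filter-tail {n} s p = begin
    ∣ p ∣                                                  ≡⟨ ∣p∣≡length-filter-allFin p ⟩
    length (filter (_∈? p) (allFin n))                     ≡⟨ length-filter-map (_∈? s ∷ p) (_∈? p) Fin.suc
                                                                (λ _ → mk⇔ drop-there Vec.there) (allFin n) ⟨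
    length (filter (_∈? s ∷ p) (map Fin.suc (allFin n)))   ≡⟨ cong (length ∘ filter (_∈? s ∷ p)) (map-tabulate id Fin.suc) ⟩
    length (filter (_∈? s ∷ p) (tabulate Fin.suc))         ∎
    where open ≡-Reasoning

module _ {n} {u v : Fin n} where

  v∈moveEdge : ∀ f → v ∈ moveEdge u v f
  v∈moveEdge f = x∈p∪q⁺ (inj₂ (x∈⁅x⁆ v))

  u∉moveEdge : u ≢ v → ∀ f → u ∉ moveEdge u v f
  u∉moveEdge u≢v f u∈ with x∈p∪q⁻ (f ─ ⁅ u ⁆) ⁅ v ⁆ u∈
  ... | inj₁ u∈f-u = x∈p─q⇒x∉q f ⁅ u ⁆ u∈f-u (x∈⁅x⁆ u)
  ... | inj₂ u∈⁅v⁆ = u≢v (x∈⁅y⁆⇒x≡y v u∈⁅v⁆)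

  ∈moveEdge⇔∈ : ∀ {w} → w ≢ u → w ≢ v → ∀ f → w ∈ moveEdge u v f ⇔ w ∈ f
  ∈moveEdge⇔∈ {w} w≢u w≢v f = mk⇔ to (λ w∈f → x∈p∪q⁺ (inj₁ (x∈p∧x≢y⇒x∈p-y w∈f w≢u)))
    where
    to : w ∈ moveEdge u v f → w ∈ f
    to w∈ with x∈p∪q⁻ (f ─ ⁅ u ⁆) ⁅ v ⁆ w∈
    ... | inj₁ w∈f-u = p─q⊆p f ⁅ u ⁆ w∈f-u
    ... | inj₂ w∈⁅v⁆ = contradiction (x∈⁅y⁆⇒x≡y v w∈⁅v⁆) w≢v

module _ {n : ℕ} where

  degree-++ : ∀ (E₁ E₂ : List (Subset n)) w → degree (E₁ ++ E₂) w ≡ degree E₁ w + degree E₂ w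
  degree-++ E₁ E₂ w = trans (cong length (filter-++ (w ∈?_) E₁ E₂)) (length-++ (filter (w ∈?_) E₁))

  degree-↭ : ∀ {E₁ E₂ : List (Subset n)} → E₁ ↭ E₂ → ∀ w → degree E₁ w ≡ degree E₂ w
  degree-↭ E₁↭E₂ w = ↭-length (filter-↭ (w ∈?_) E₁↭E₂)

  degree-all : ∀ {F : List (Subset n)} {w} → All (w ∈_) F → degree F w ≡ length F
  degree-all {w = w} w∈F = cong length (filter-all (w ∈?_) w∈F)

  degree-none : ∀ {F : List (Subset n)} {w} → All (w ∉_) F → degree F w ≡ 0
  degree-none {w = w} w∉F = cong length (filter-none (w ∈?_) w∉F)

  degree-map : ∀ (g : Subset n → Subset n) {w} → (∀ f → w ∈ g f ⇔ w ∈ f) → ∀ F → degree (map g F) w ≡ degree F w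
  degree-map g {w} w∈g⇔ = length-filter-map (w ∈?_) (w ∈?_) g w∈g⇔

  degree-filter-complement : ∀ {E P : List (Subset n)} → Unique E → Unique P → P ⊆ E →
    ∀ w → degree E w ≡ degree P w + degree (filter (λ f → ¬? (f ∈ₑ? P)) E) w
  degree-filter-complement {E} {P} E! P! P⊆E w =
    trans (length-filter-partition (_∈ₑ? P) (w ∈?_) E)
          (cong (_+ degree (filter (λ f → ¬? (f ∈ₑ? P)) E) w) (degree-↭ (filter-∈-↭ _≟ₛ_ E! P! P⊆E) w))

  coreCount+2≤∣f∣ : ∀ {E f} {x y : Fin n} → x ∈ f → y ∈ f → x ≢ y → ¬ Core E x → ¬ Core E y →
    coreCount E f + 2 ≤ ∣ f ∣
  coreCount+2≤∣f∣ {E} {f} {x} {y} x∈f y∈f x≢y x-nonCore y-nonCore = begin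
    coreCount E f + 2                    ≤⟨ +-monoʳ-≤ (coreCount E f) (2≤length (nonCore∈ x∈f x-nonCore) (nonCore∈ y∈f y-nonCore) x≢y) ⟩
    coreCount E f + length nonCoreOf-f   ≡⟨ length-filter-partition core? (_∈? f) (allFin n) ⟨
    length (filter (_∈? f) (allFin n))   ≡⟨ ∣p∣≡length-filter-allFin f ⟨
    ∣ f ∣                                ∎
    where
    open ≤-Reasoning
    core? : Decidable (Core E)
    core? w = degree E w ≟ℕ 1
    nonCoreOf-f : List (Fin n)
    nonCoreOf-f = filter (_∈? f) (filter (∁? core?) (allFin n))
    nonCore∈ : ∀ {w} → w ∈ f → ¬ Core E w → w ∈ˡ nonCoreOf-f
    nonCore∈ {w} w∈f w-nonCore = ∈-filter⁺ (_∈? f) (∈-filter⁺ (∁? core?) (∈-allFin w) w-nonCore) w∈f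

  pendent-nonCore-unique : ∀ {E f} {x y : Fin n} → Pendent E f → x ∈ f → y ∈ f → ¬ Core E x → ¬ Core E y → x ≡ y
  pendent-nonCore-unique {E} {f} {x} {y} pendent x∈f y∈f x-nonCore y-nonCore with x ≟ᶠ y
  ... | yes x≡y = x≡y
  ... | no x≢y  = contradiction
    (subst (λ c → c + 2 ≤ ∣ f ∣) pendent (coreCount+2≤∣f∣ {E} x∈f y∈f x≢y x-nonCore y-nonCore))
    (pred+2≰ ∣ f ∣)
    where
    pred+2≰ : ∀ k → ¬ (k ∸ 1 + 2 ≤ k)
    pred+2≰ zero    ()
    pred+2≰ (suc k) k+2≤1+k = <-irrefl refl (subst (_≤ suc k) (+-comm k 2) k+2≤1+k)

module _ {n} {E P : List (Subset n)} {u v : Fin n} (E! : Unique E) (P! : Unique P) (P⊆E : P ⊆ E) where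

  degree-transform : ∀ w → degree (transform E P u v) w + degree P w ≡ degree E w + degree (map (moveEdge u v) P) w
  degree-transform w = begin
    degree (transform E P u v) w + degree P w ≡⟨ cong (_+ degree P w) (degree-++ Rest Moved w) ⟩
    degree Rest w + degree Moved w + degree P w ≡⟨ xy∙z≈zx∙y (degree Rest w) _ _ ⟩
    degree P w + degree Rest w + degree Moved w ≡⟨ cong (_+ degree Moved w) (degree-filter-complement E! P! P⊆E w) ⟨
    degree E w + degree Moved w ∎
    where
    open ≡-Reasoning
    Rest = filter (λ f → ¬? (f ∈ₑ? P)) E
    Moved = map (moveEdge u v) P

  degree-transform-other : ∀ {w} → w ≢ u → w ≢ v → degree (transform E P u v) w ≡ degree E w
  degree-transform-other {w} w≢u w≢v = +-cancelʳ-≡ (degree P w) _ _ (begin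
    degree (transform E P u v) w + degree P w          ≡⟨ degree-transform w ⟩
    degree E w + degree (map (moveEdge u v) P) w       ≡⟨ cong (degree E w +_) (degree-map (moveEdge u v) (∈moveEdge⇔∈ w≢u w≢v) P) ⟩
    degree E w + degree P w                            ∎)
    where open ≡-Reasoning

  degree-transform-source : u ≢ v → All (u ∈_) P → degree (transform E P u v) u + length P ≡ degree E u
  degree-transform-source u≢v u∈P = begin
    degree (transform E P u v) u + length P      ≡⟨ cong (degree (transform E P u v) u +_) (degree-all u∈P) ⟨
    degree (transform E P u v) u + degree P u    ≡⟨ degree-transform u ⟩
    degree E u + degree (map (moveEdge u v) P) u ≡⟨ cong (degree E u +_) (degree-none (map⁺ (universal (u∉moveEdge u≢v) P))) ⟩
    degree E u + 0                               ≡⟨ +-identityʳ (degree E u) ⟩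
    degree E u                                   ∎
    where open ≡-Reasoning

  degree-transform-target : All (v ∉_) P → degree (transform E P u v) v ≡ degree E v + length P
  degree-transform-target v∉P = begin
    degree (transform E P u v) v                 ≡⟨ +-identityʳ _ ⟨
    degree (transform E P u v) v + 0             ≡⟨ cong (degree (transform E P u v) v +_) (degree-none v∉P) ⟨
    degree (transform E P u v) v + degree P v    ≡⟨ degree-transform v ⟩
    degree E v + degree (map (moveEdge u v) P) v ≡⟨ cong (degree E v +_) (degree-all (map⁺ (universal v∈moveEdge P))) ⟩
    degree E v + length (map (moveEdge u v) P)   ≡⟨ cong (degree E v +_) (length-map (moveEdge u v) P) ⟩
    degree E v + length P                        ∎
    where open ≡-Reasoning

zagreb-<-exchange₂ : ∀ {n} {E E′ : List (Subset n)} {u v} → u ≢ v →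
  (∀ {w} → w ≢ u → w ≢ v → degree E w ≡ degree E′ w) →
  degree E u * degree E u + degree E v * degree E v < degree E′ u * degree E′ u + degree E′ v * degree E′ v →
  zagreb E < zagreb E′
zagreb-<-exchange₂ {n} {E} {E′} {u} {v} u≢v agree =
  sum-map-<-exchange₂ (λ w → degree E w * degree E w) (λ w → degree E′ w * degree E′ w)
    (allFin⁺ n) (∈-allFin u) (∈-allFin v) u≢v (λ _ w≢u w≢v → cong (λ d → d * d) (agree w≢u w≢v))

lemma2p2 : (n m : ℕ) (E : List (Subset n)) →
  All (λ f → ∣ f ∣ ≡ m) E → Unique E →
  (e : Subset n) (u v : Fin n) → e ∈ₑ E → u ∈ e → v ∈ e → u ≢ v →
  (P : List (Subset n)) → Unique P →
  (∀ f → f ∈ₑ P → f ∈ₑ E × Pendent E f × u ∈ f) →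
  (∀ f → f ∈ₑ E → Pendent E f → u ∈ f → f ∈ₑ P) →
  1 ≤ length P →
  degree E u ≡ suc (length P) →
  2 ≤ degree E v →
  zagreb E < zagreb (transform E P u v)
lemma2p2 n _ E _ E! _ u v _ _ _ u≢v P P! P-pendent _ 0<t deg-u 1<deg-v =
  zagreb-<-exchange₂ {E = E} {E′} u≢v (λ w≢u w≢v → sym (degree-transform-other E! P! P⊆E w≢u w≢v)) (begin-strict
    degree E u * degree E u + degree E v * degree E v ≡⟨ cong (λ d → d * d + degree E v * degree E v) deg-u ⟩
    (1 + t) * (1 + t) + degree E v * degree E v       <⟨ sum-of-squares-shift-< 1 (degree E v) t 1<deg-v 0<t ⟩
    1 * 1 + (degree E v + t) * (degree E v + t)       ≡⟨ cong₂ (λ a b → a * a + b * b) deg′-u deg′-v ⟨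
    degree E′ u * degree E′ u + degree E′ v * degree E′ v ∎)
  where
  open ≤-Reasoning
  t = length P
  E′ = transform E P u v
  P⊆E : P ⊆ E
  P⊆E f∈P = proj₁ (P-pendent _ f∈P)
  u-nonCore : ¬ Core E u
  u-nonCore deg≡1 = <⇒≢ 0<t (sym (suc-injective (trans (sym deg-u) deg≡1)))
  v-nonCore : ¬ Core E v
  v-nonCore deg≡1 = <-irrefl (sym deg≡1) 1<deg-v
  u∈P : All (u ∈_) P
  u∈P = All.tabulate (λ f∈P → proj₂ (proj₂ (P-pendent _ f∈P)))
  v∉P : All (v ∉_) P
  v∉P = All.tabulate (λ f∈P v∈f → let _ , pendent , u∈f = P-pendent _ f∈P in
    u≢v (pendent-nonCore-unique {E = E} pendent u∈f v∈f u-nonCore v-nonCore))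
  deg′-u : degree E′ u ≡ 1
  deg′-u = +-cancelʳ-≡ t _ 1 (trans (degree-transform-source E! P! P⊆E u≢v u∈P) deg-u)
  deg′-v : degree E′ v ≡ degree E v + t
  deg′-v = degree-transform-target E! P! P⊆E v∉P
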